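{- Let $p\ge 3$ be an integer, $t=2p-2$, and let $G$ be a simple undirected graph in which every vertex has degree at most $t+1$. Let $H$ be any dense subgraph of $G$. Then every $K^p_2$ of $G$ that shares a vertex with $H$ has the same vertex set as $H$.
   Context: $K^p_2$ is the complete $p$-partite graph with $p$ color classes of $2$ vertices each; a "$K^p_2$ of $G$" is a subgraph of $G$ (not necessarily induced) isomorphic to it. For $A\subseteq V(G)$ with $|A|=2p$, the induced subgraph $G[A]$ is dense if it contains at least two different $K^p_2$'s. -}

module Defs where

open import Data.Nat using (ℕ; _+_; _*_; _∸_; _≤_)
open import Data.Bool using (Bool; true; false)
open import Data.Fin using (Fin)
open import Data.Fin.Subset using (Subset; _∈_; ∣_∣)
open import Data.Vec using (tabulate)
open import Data.Product using (_×_; ∃; ∃-syntax; Σ-syntax)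
open import Relation.Binary.PropositionalEquality using (_≡_; _≢_)
open import Relation.Nullary using (¬_)
open import Function.Bundles using (_⇔_)

record Graph (n : ℕ) : Set where
  field
    adj    : Fin n → Fin n → Bool
    sym    : ∀ u v → adj u v ≡ adj v u
    irrefl : ∀ v → adj v v ≡ false
open Graph public

nbhd : ∀ {n} → Graph n → Fin n → Subset n
nbhd G v = tabulate (adj G v)

degree : ∀ {n} → Graph n → Fin n → ℕ
degree G v = ∣ nbhd G v ∣

-- A K^p_2 of G: an injective map from the vertices (i , a) of K^p_2
-- (colour class i : Fin p, position a : Fin 2) into V(G) such that
-- vertices in different colour classes are mapped to adjacent vertices.
record K2 {n : ℕ} (p : ℕ) (G : Graph n) : Set where
  field
    emb  : Fin p → Fin 2 → Fin n
    inj  : ∀ i a j b → emb i a ≡ emb j b → (i ≡ j) × (a ≡ b)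
    edge : ∀ i j a b → i ≢ j → adj G (emb i a) (emb j b) ≡ true
open K2 public

InV : ∀ {n p} {G : Graph n} → K2 p G → Fin n → Set
InV K x = ∃[ i ] ∃[ a ] emb K i a ≡ x

InE : ∀ {n p} {G : Graph n} → K2 p G → Fin n → Fin n → Set
InE K x y = ∃[ i ] ∃[ j ] ∃[ a ] ∃[ b ] (i ≢ j × emb K i a ≡ x × emb K j b ≡ y)

SameSubgraph : ∀ {n p} {G : Graph n} → K2 p G → K2 p G → Set
SameSubgraph K L = (∀ x → InV K x ⇔ InV L x) × (∀ x y → InE K x y ⇔ InE L x y)

InsideOf : ∀ {n p} {G : Graph n} → K2 p G → Subset n → Set
InsideOf K A = ∀ i a → emb K i a ∈ A

Dense : ∀ {n} (p : ℕ) (G : Graph n) → Subset n → Set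
Dense p G A = (∣ A ∣ ≡ 2 * p) ×
  (Σ[ K ∈ K2 p G ] Σ[ L ∈ K2 p G ] (InsideOf K A × InsideOf L A × ¬ SameSubgraph K L))

-- Every K^p_2 lying in A covers A, since |A| = 2p, and by the degree bound no
-- vertex sees 2p distinct vertices.  Exchanging one or two vertices of a
-- K^p_2 inside A for outside vertices therefore shows that a universal vertex
-- of G[A] has no neighbour outside A, and that any vertex of A has at most
-- one.  Two different K^p_2's inside A pair up the vertices of A differently,
-- and where the pairings differ we find three universal vertices.  On the
-- other hand, if a K^p_2 M meets A but leaves it, then at most one of its
-- vertices lies outside (here p ≥ 3 provides a third colour class), and a
-- universal vertex is either the partner in M of that vertex or the unique
-- vertex of A missed by M: at most two universal vertices.
module Submission where

open import Defs
open import Data.Nat as ℕ using (ℕ; _+_; _*_; _∸_; _≤_; _<_; z≤n; s≤s)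
open import Data.Nat.Properties using (≤-reflexive; ≤-trans; ≤-<-trans; <⇒≱; +-comm; *-comm)
open import Data.Bool using (true)
open import Data.Fin using (Fin; zero; suc; _≟_)
open import Data.Fin.Properties using (any?; suc-injective; 0≢1+n; *↔×)
open import Data.Fin.Subset using (Subset; _∈_; _∉_; ∣_∣; _-_)
open import Data.Fin.Subset.Properties using (_∈?_; x∈p∧x≢y⇒x∈p-y; x∈p⇒∣p-x∣<∣p∣)
open import Data.Vec.Properties using (lookup⇒[]=; lookup∘tabulate)
open import Data.Product using (∃-syntax; _×_; _,_; proj₁; proj₂; uncurry)
open import Data.Product.Properties using (≡-dec)
open import Data.Sum using (_⊎_; inj₁; inj₂)
open import Data.Empty using (⊥; ⊥-elim)
open import Function.Bundles using (_⇔_; mk⇔; Injection)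
open import Function.Definitions using (Injective)
open import Function.Properties.Inverse using (Inverse⇒Injection)
open import Relation.Binary.Definitions using (DecidableEquality)
open import Relation.Nullary using (¬_; Dec; yes; no)
open import Relation.Nullary.Decidable using (decidable-stable)
import Relation.Binary.PropositionalEquality as ≡
open ≡ using (_≡_; _≢_; refl; subst; cong; ≢-sym)

m∸2+1<m : ∀ {m} → 2 ≤ m → m ∸ 2 + 1 < m
m∸2+1<m (s≤s (s≤s {n = k} z≤n)) = s≤s (≤-reflexive (+-comm k 1))

injection⇒≤∣∣ : ∀ {m n} {S : Subset n} (f : Fin m → Fin n) →
                Injective _≡_ _≡_ f → (∀ k → f k ∈ S) → m ≤ ∣ S ∣
injection⇒≤∣∣ {ℕ.zero} f f-inj f∈S = z≤n
injection⇒≤∣∣ {ℕ.suc m} f f-inj f∈S =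
  ≤-trans (s≤s (injection⇒≤∣∣ (λ k → f (suc k)) (λ e → suc-injective (f-inj e)) f∘suc∈S-f0))
          (x∈p⇒∣p-x∣<∣p∣ (f∈S zero))
  where
  f∘suc∈S-f0 : ∀ k → f (suc k) ∈ _ - f zero
  f∘suc∈S-f0 k = x∈p∧x≢y⇒x∈p-y (f∈S (suc k)) (λ e → 0≢1+n (≡.sym (f-inj e)))

no-three-in-two-subsingletons :
  ∀ {X : Set} {U P Q : X → Set} →
  (∀ {x} → U x → P x ⊎ Q x) →
  (∀ {x y} → P x → P y → x ≡ y) → (∀ {x y} → Q x → Q y → x ≡ y) →
  ∀ {x y z} → U x → U y → U z → x ≢ y → x ≢ z → y ≢ z → ⊥
no-three-in-two-subsingletons split P! Q! Ux Uy Uz x≢y x≢z y≢z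
  with split Ux | split Uy | split Uz
... | inj₁ Px | inj₁ Py | _      = x≢y (P! Px Py)
... | inj₂ Qx | inj₂ Qy | _      = x≢y (Q! Qx Qy)
... | inj₁ Px | inj₂ _  | inj₁ Pz = x≢z (P! Px Pz)
... | inj₂ Qx | inj₁ _  | inj₂ Qz = x≢z (Q! Qx Qz)
... | inj₁ _  | inj₂ Qy | inj₂ Qz = y≢z (Q! Qy Qz)
... | inj₂ _  | inj₁ Py | inj₁ Pz = y≢z (P! Py Pz)

other : Fin 2 → Fin 2
other zero       = suc zero
other (suc zero) = zero

other-involutive : ∀ a → other (other a) ≡ a
other-involutive zero       = refl
other-involutive (suc zero) = refl

other-≢ : ∀ a → other a ≢ a
other-≢ zero       ()
other-≢ (suc zero) ()

≡⊎≡other : ∀ a c → c ≡ a ⊎ c ≡ other a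
≡⊎≡other zero       zero       = inj₁ refl
≡⊎≡other zero       (suc zero) = inj₂ refl
≡⊎≡other (suc zero) zero       = inj₂ refl
≡⊎≡other (suc zero) (suc zero) = inj₁ refl

third-class : ∀ {p} → 3 ≤ p → (i j : Fin p) → ∃[ m ] m ≢ i × m ≢ j
third-class (s≤s (s≤s (s≤s _))) i j with i ≟ zero | j ≟ zero
... | no i≢0   | no j≢0   = zero , ≢-sym i≢0 , ≢-sym j≢0
... | yes refl | _        with j ≟ suc zero
...   | yes refl = suc (suc zero) , (λ ()) , (λ ())
...   | no j≢1   = suc zero , (λ ()) , ≢-sym j≢1
third-class (s≤s (s≤s (s≤s _))) i j | no i≢0 | yes refl with i ≟ suc zero
...   | yes refl = suc (suc zero) , (λ ()) , (λ ())
...   | no i≢1   = suc zero , ≢-sym i≢1 , (λ ())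

Index : ℕ → Set
Index p = Fin p × Fin 2

partner : ∀ {p} → Index p → Index p
partner (i , a) = i , other a

_≟ᵢ_ : ∀ {p} → DecidableEquality (Index p)
_≟ᵢ_ = ≡-dec _≟_ _≟_

different-class : ∀ {p} {k l : Index p} → l ≢ k → l ≢ partner k → proj₁ l ≢ proj₁ k
different-class {k = i , a} {l = .i , c} l≢k l≢k′ refl with ≡⊎≡other a c
... | inj₁ refl = l≢k refl
... | inj₂ refl = l≢k′ refl

injection-index⇒≤∣∣ : ∀ {p n} {S : Subset n} (f : Index p → Fin n) →
                      Injective _≡_ _≡_ f → (∀ k → f k ∈ S) → 2 * p ≤ ∣ S ∣
injection-index⇒≤∣∣ {p} {S = S} f f-inj f∈S =
  subst (_≤ ∣ S ∣) (*-comm p 2) (injection⇒≤∣∣ (λ k → f (to k)) (λ e → injective (f-inj e)) (λ k → f∈S (to k)))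
  where open Injection (Inverse⇒Injection (*↔× {p} {2}))

image? : ∀ {p n} (f : Index p → Fin n) x → Dec (∃[ i ] ∃[ a ] f (i , a) ≡ x)
image? f x = any? λ i → any? λ a → f (i , a) ≟ x

injection-index-covers : ∀ {p n} {S : Subset n} {f : Index p → Fin n} →
                         Injective _≡_ _≡_ f → (∀ k → f k ∈ S) → ∣ S ∣ ≤ 2 * p →
                         ∀ {x} → x ∈ S → ∃[ i ] ∃[ a ] f (i , a) ≡ x
injection-index-covers {f = f} f-inj f∈S ∣S∣≤2p {x} x∈S with image? f x
... | yes hit = hit
... | no miss = ⊥-elim (<⇒≱ (≤-<-trans (injection-index⇒≤∣∣ f f-inj f∈S-x) (x∈p⇒∣p-x∣<∣p∣ x∈S)) ∣S∣≤2p)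
  where
  f∈S-x : ∀ k → f k ∈ _ - x
  f∈S-x (i , a) = x∈p∧x≢y⇒x∈p-y (f∈S (i , a)) (λ e → miss (i , a , e))

module Update {I : Set} (_≟ᴵ_ : DecidableEquality I) where

  update : ∀ {B : Set} → (I → B) → I → B → I → B
  update f i y k with k ≟ᴵ i
  ... | yes _ = y
  ... | no  _ = f k

  update-elim : ∀ {B : Set} (P : B → Set) {f : I → B} {i y} k →
                (k ≡ i → P y) → (k ≢ i → P (f k)) → P (update f i y k)
  update-elim P {i = i} k Py Pf with k ≟ᴵ i
  ... | yes k≡i = Py k≡i
  ... | no  k≢i = Pf k≢i

  update-all : ∀ {B : Set} (P : B → Set) {f : I → B} {i y} →
               P y → (∀ k → k ≢ i → P (f k)) → ∀ k → P (update f i y k)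
  update-all P Py Pf k = update-elim P k (λ _ → Py) (Pf k)

  update-injective : ∀ {B : Set} {f : I → B} {i y} → Injective _≡_ _≡_ f →
                     (∀ k → k ≢ i → f k ≢ y) → Injective _≡_ _≡_ (update f i y)
  update-injective {i = i} f-inj fresh {k} {l} e with k ≟ᴵ i | l ≟ᴵ i
  ... | yes refl | yes refl = refl
  ... | yes _    | no  l≢i  = ⊥-elim (fresh l l≢i (≡.sym e))
  ... | no  k≢i  | yes _    = ⊥-elim (fresh k k≢i e)
  ... | no  _    | no  _    = f-inj e

module _ {n : ℕ} (G : Graph n) where

  infix 4 _∼_
  _∼_ : Fin n → Fin n → Set
  u ∼ v = adj G u v ≡ true

  ∼-sym : ∀ {u v} → u ∼ v → v ∼ u
  ∼-sym {u} {v} u∼v = ≡.trans (Graph.sym G v u) u∼v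

  ∼⇒∈nbhd : ∀ {u v} → u ∼ v → v ∈ nbhd G u
  ∼⇒∈nbhd {u} {v} u∼v = lookup⇒[]= v (nbhd G u) (≡.trans (lookup∘tabulate (adj G u) v) u∼v)

  vertex : ∀ {p} → K2 p G → Index p → Fin n
  vertex K = uncurry (emb K)

  vertex-injective : ∀ {p} (K : K2 p G) → Injective _≡_ _≡_ (vertex K)
  vertex-injective K {i , a} {j , b} e with inj K i a j b e
  ... | refl , refl = refl

  vertex-∼ : ∀ {p} (K : K2 p G) {k l : Index p} → proj₁ k ≢ proj₁ l → vertex K k ∼ vertex K l
  vertex-∼ K {i , a} {j , b} = edge K i j a b

  data Mates {p} (K : K2 p G) (x y : Fin n) : Set where
    mates : ∀ i a → emb K i a ≡ x → emb K i (other a) ≡ y → Mates K x y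

  module _ {p : ℕ} {K : K2 p G} where

    mate-exists : ∀ {x} → InV K x → ∃[ y ] Mates K x y
    mate-exists (i , a , x≡) = emb K i (other a) , mates i a x≡ refl

    Mates⇒InV : ∀ {x y} → Mates K x y → InV K x
    Mates⇒InV (mates i a x≡ _) = i , a , x≡

    mates-sym : ∀ {x y} → Mates K x y → Mates K y x
    mates-sym (mates i a x≡ y≡) = mates i (other a) y≡ (≡.trans (cong (emb K i) (other-involutive a)) x≡)

    mates-functional : ∀ {x y z} → Mates K x y → Mates K x z → y ≡ z
    mates-functional (mates i a refl refl) (mates j b e refl) with inj K j b i a e
    ... | refl , refl = refl

    mates-≢ : ∀ {x y} → Mates K x y → x ≢ y
    mates-≢ (mates i a refl refl) e = other-≢ a (≡.sym (proj₂ (inj K i a i (other a) e)))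

    InE⇒∼ : ∀ {x y} → InE K x y → x ∼ y
    InE⇒∼ (i , j , a , b , i≢j , refl , refl) = edge K i j a b i≢j

    InE⇒≢ : ∀ {x y} → InE K x y → x ≢ y
    InE⇒≢ (i , j , a , b , i≢j , refl , refl) e = i≢j (proj₁ (inj K i a j b e))

    InE⇒¬Mates : ∀ {x y} → InE K x y → ¬ Mates K x y
    InE⇒¬Mates (i , j , a , b , i≢j , refl , refl) (mates k c x≡ y≡) =
      i≢j (≡.trans (≡.sym (proj₁ (inj K k c i a x≡))) (proj₁ (inj K k (other c) j b y≡)))

    InE⊎Mates : ∀ {x y} → InV K x → InV K y → x ≢ y → InE K x y ⊎ Mates K x y
    InE⊎Mates (i , a , refl) (j , b , refl) x≢y with i ≟ j
    ... | no i≢j = inj₁ (i , j , a , b , i≢j , refl , refl)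
    ... | yes refl with ≡⊎≡other a b
    ...   | inj₁ refl = ⊥-elim (x≢y refl)
    ...   | inj₂ refl = inj₂ (mates i a refl refl)

    ∼⊎Mates : ∀ {x y} → InV K x → InV K y → x ≢ y → x ∼ y ⊎ Mates K x y
    ∼⊎Mates x∈K y∈K x≢y with InE⊎Mates x∈K y∈K x≢y
    ... | inj₁ xy∈E = inj₁ (InE⇒∼ xy∈E)
    ... | inj₂ x~y = inj₂ x~y

  module Bounded {p : ℕ} (Δ< : ∀ v → degree G v < 2 * p)
                 (A : Subset n) (∣A∣≤2p : ∣ A ∣ ≤ 2 * p) where

    open Update (_≟ᵢ_ {p})

    Dominates : Fin n → (Index p → Fin n) → Set
    Dominates s f = ∀ k → s ∼ f k

    ¬dominates : ∀ {s f} → Injective _≡_ _≡_ f → ¬ Dominates s f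
    ¬dominates {s} {f} f-inj s∼f = <⇒≱ (Δ< s) (injection-index⇒≤∣∣ f f-inj (λ k → ∼⇒∈nbhd (s∼f k)))

    Universal : Fin n → Set
    Universal d = d ∈ A × (∀ {z} → z ∈ A → z ≢ d → d ∼ z)

    AtMostTwoUniversal : Set
    AtMostTwoUniversal = ∀ {u v w} → Universal u → Universal v → Universal w →
                         u ≢ v → u ≢ w → v ≢ w → ⊥

    module Inside (K : K2 p G) (K⊆A : InsideOf K A) where

      vertex∈ : ∀ k → vertex K k ∈ A
      vertex∈ (i , a) = K⊆A i a

      covers : ∀ {x} → x ∈ A → InV K x
      covers = injection-index-covers (vertex-injective K) vertex∈ ∣A∣≤2p

      InV⇒∈ : ∀ {x} → InV K x → x ∈ A
      InV⇒∈ (i , a , refl) = K⊆A i a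

      fresh-outside : ∀ {y} → y ∉ A → ∀ k → vertex K k ≢ y
      fresh-outside y∉A k e = y∉A (subst (_∈ A) e (vertex∈ k))

      mate-universal : ∀ {x y} → Mates K x y → x ∼ y → Universal x
      mate-universal x~y@(mates i a refl _) x∼y = K⊆A i a , x∼A
        where
        x∼A : ∀ {z} → z ∈ A → z ≢ emb K i a → emb K i a ∼ z
        x∼A z∈A z≢x with ∼⊎Mates (i , a , refl) (covers z∈A) (≢-sym z≢x)
        ... | inj₁ x∼z = x∼z
        ... | inj₂ x~z = subst (_ ∼_) (mates-functional x~y x~z) x∼y

      -- Swapping d's own vertex of K for y would give d 2p distinct neighbours.
      universal-neighbours-inside : ∀ {d y} → Universal d → d ∼ y → y ∈ A
      universal-neighbours-inside {d} {y} (d∈A , d∼A) d∼y with y ∈? A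
      ... | yes y∈A = y∈A
      ... | no  y∉A with covers d∈A
      ...   | i , a , refl =
        ⊥-elim (¬dominates (update-injective (vertex-injective K) (λ k _ → fresh-outside y∉A k))
                           (update-all (d ∼_) d∼y λ k k≢ → d∼A (vertex∈ k) (λ e → k≢ (vertex-injective K e))))

      -- Swapping the colour class of s in K for the two outer neighbours.
      outer-neighbour-unique : ∀ {s y y′} → s ∈ A → s ∼ y → s ∼ y′ → y ∉ A → y′ ∉ A → y ≡ y′
      outer-neighbour-unique {s} {y} {y′} s∈A s∼y s∼y′ y∉A y′∉A with y ≟ y′
      ... | yes y≡y′ = y≡y′
      ... | no  y≢y′ with covers s∈A
      ...   | i , a , refl = ⊥-elim (¬dominates (update-injective f-inj f-fresh) s∼f′)
        where
        f : Index p → Fin n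
        f = update (vertex K) (i , a) y
        f-inj : Injective _≡_ _≡_ f
        f-inj = update-injective (vertex-injective K) (λ k _ → fresh-outside y∉A k)
        f-fresh : ∀ k → k ≢ (i , other a) → f k ≢ y′
        f-fresh k _ = update-all (_≢ y′) y≢y′ (λ l _ → fresh-outside y′∉A l) k
        s∼f′ : Dominates s (update f (i , other a) y′)
        s∼f′ = update-all (s ∼_) s∼y′ λ l l≢k′ → update-elim (s ∼_) l (λ _ → s∼y) λ l≢k →
                 vertex-∼ K (≢-sym (different-class l≢k l≢k′))

    module Meets (X : K2 p G) (X⊆A : InsideOf X A) (3≤p : 3 ≤ p)
                 (M : K2 p G) (k₀ : Index p) (k₀∈A : vertex M k₀ ∈ A) where

      open Inside X X⊆A

      outside-twins : ∀ {s k l} → s ∈ A → s ∼ vertex M k → s ∼ vertex M l →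
                      vertex M k ∉ A → vertex M l ∉ A → k ≡ l
      outside-twins s∈A s∼k s∼l k∉A l∉A =
        vertex-injective M (outer-neighbour-unique s∈A s∼k s∼l k∉A l∉A)

      ¬outside-on-and-off-class-of-k₀ : ∀ {k l} → proj₁ k ≡ proj₁ k₀ → proj₁ l ≢ proj₁ k₀ →
                                        vertex M k ∉ A → vertex M l ∉ A → ⊥
      ¬outside-on-and-off-class-of-k₀ {k} {l} k≡ l≢ k∉A l∉A with third-class 3≤p (proj₁ k₀) (proj₁ l)
      ... | m , m≢k₀ , m≢l with vertex M (m , zero) ∈? A
      ...   | yes t∈A = l≢ (≡.trans (cong proj₁ (≡.sym (outside-twins t∈A t∼k t∼l k∉A l∉A))) k≡)
        where
        t∼k : vertex M (m , zero) ∼ vertex M k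
        t∼k = vertex-∼ M (λ e → m≢k₀ (≡.trans e k≡))
        t∼l : vertex M (m , zero) ∼ vertex M l
        t∼l = vertex-∼ M m≢l
      ...   | no  t∉A = m≢l (cong proj₁ (outside-twins k₀∈A (vertex-∼ M (≢-sym m≢k₀))
                                          (vertex-∼ M (≢-sym l≢)) t∉A l∉A))

      outside-partner : ∀ {k} → proj₁ k ≡ proj₁ k₀ → vertex M k ∉ A → k ≡ partner k₀
      outside-partner {k} k≡ k∉A = decidable-stable (k ≟ᵢ partner k₀) λ k≢k₀′ →
        different-class (λ e → k∉A (subst (λ k → vertex M k ∈ A) (≡.sym e) k₀∈A)) k≢k₀′ k≡

      at-most-one-outside : ∀ {k l} → vertex M k ∉ A → vertex M l ∉ A → k ≡ l
      at-most-one-outside {k} {l} k∉A l∉A with proj₁ k ≟ proj₁ k₀ | proj₁ l ≟ proj₁ k₀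
      ... | no  k≢ | no  l≢ = outside-twins k₀∈A (vertex-∼ M (≢-sym k≢)) (vertex-∼ M (≢-sym l≢)) k∉A l∉A
      ... | yes k≡ | yes l≡ = ≡.trans (outside-partner k≡ k∉A) (≡.sym (outside-partner l≡ l∉A))
      ... | yes k≡ | no  l≢ = ⊥-elim (¬outside-on-and-off-class-of-k₀ k≡ l≢ k∉A l∉A)
      ... | no  k≢ | yes l≡ = ⊥-elim (¬outside-on-and-off-class-of-k₀ l≡ k≢ l∉A k∉A)

      mate-of-outside : ∀ {j d} → vertex M j ∉ A → Universal d → InV M d → Mates M (vertex M j) d
      mate-of-outside {j} j∉A Ud d∈M
        with ∼⊎Mates {K = M} (proj₁ j , proj₂ j , refl) d∈M (λ e → j∉A (subst (_∈ A) (≡.sym e) (proj₁ Ud)))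
      ... | inj₁ j∼d = ⊥-elim (j∉A (universal-neighbours-inside Ud (∼-sym j∼d)))
      ... | inj₂ j~d = j~d

      inside-except : ∀ {j k} → vertex M j ∉ A → k ≢ j → vertex M k ∈ A
      inside-except j∉A k≢j = decidable-stable (_ ∈? A) λ k∉A → k≢j (at-most-one-outside k∉A j∉A)

      -- M with its outside vertex replaced by d′ still covers A, yet misses d.
      non-vertices-unique : ∀ {j d d′} → vertex M j ∉ A → d ∈ A → d′ ∈ A →
                            ¬ InV M d → ¬ InV M d′ → d ≡ d′
      non-vertices-unique {j} {d} {d′} j∉A d∈A d′∈A d∉M d′∉M = decidable-stable (d ≟ d′) λ d≢d′ →
        let i , a , hit = injection-index-covers
                            (update-injective {i = j} (vertex-injective M) λ k _ e → d′∉M (_ , _ , e))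
                            (update-all (_∈ A) d′∈A λ k → inside-except j∉A) ∣A∣≤2p d∈A
        in update-all (_≢ d) (≢-sym d≢d′) (λ k _ e → d∉M (_ , _ , e)) (i , a) hit

      at-most-two-universal : ∀ {j} → vertex M j ∉ A → AtMostTwoUniversal
      at-most-two-universal {j} j∉A =
        no-three-in-two-subsingletons split mates-functional
          (λ (d∈A , d∉M) (d′∈A , d′∉M) → non-vertices-unique j∉A d∈A d′∈A d∉M d′∉M)
        where
        split : ∀ {d} → Universal d → Mates M (vertex M j) d ⊎ (d ∈ A × ¬ InV M d)
        split {d} Ud with image? (vertex M) d
        ... | yes d∈M = inj₁ (mate-of-outside j∉A Ud d∈M)
        ... | no  d∉M = inj₂ (proj₁ Ud , d∉M)

    InE-transfer : (K L : K2 p G) → InsideOf K A → InsideOf L A →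
                   (∀ {x y} → Mates L x y → Mates K x y) → ∀ {x y} → InE K x y → InE L x y
    InE-transfer K L K⊆A L⊆A L⊆K xy∈K@(i , j , a , b , _ , refl , refl)
      with InE⊎Mates (Inside.covers L L⊆A (K⊆A i a)) (Inside.covers L L⊆A (K⊆A j b)) (InE⇒≢ {K = K} xy∈K)
    ... | inj₁ xy∈L = xy∈L
    ... | inj₂ x~y  = ⊥-elim (InE⇒¬Mates {K = K} xy∈K (L⊆K x~y))

    module TwoInside (X Y : K2 p G) (X⊆A : InsideOf X A) (Y⊆A : InsideOf Y A) where

      private
        module X = Inside X X⊆A
        module Y = Inside Y Y⊆A

      -- Where the two pairings of A differ, x, its X-mate v and its Y-mate w
      -- are pairwise adjacent, hence all universal.
      mates-agree : AtMostTwoUniversal → ∀ {x v} → Mates X x v → Mates Y x v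
      mates-agree two {x} {v} mX with mate-exists (Y.covers (X.InV⇒∈ (Mates⇒InV mX)))
      ... | w , mY with v ≟ w
      ...   | yes refl = mY
      ...   | no  v≢w  = ⊥-elim (two (X.mate-universal mX x∼v) (X.mate-universal (mates-sym mX) (∼-sym x∼v))
                             (Y.mate-universal (mates-sym mY) (∼-sym x∼w)) (mates-≢ mX) (mates-≢ mY) v≢w)
        where
        x∼v : x ∼ v
        x∼v with ∼⊎Mates (Mates⇒InV mY) (Y.covers (X.InV⇒∈ (Mates⇒InV (mates-sym mX)))) (mates-≢ mX)
        ... | inj₁ x∼v = x∼v
        ... | inj₂ mY′ = ⊥-elim (v≢w (mates-functional mY′ mY))
        x∼w : x ∼ w
        x∼w with ∼⊎Mates (Mates⇒InV mX) (X.covers (Y.InV⇒∈ (Mates⇒InV (mates-sym mY)))) (mates-≢ mY)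
        ... | inj₁ x∼w = x∼w
        ... | inj₂ mX′ = ⊥-elim (v≢w (mates-functional mX mX′))

      mates-reflect : (∀ {x y} → Mates X x y → Mates Y x y) → ∀ {x y} → Mates Y x y → Mates X x y
      mates-reflect X⊆Y mY with mate-exists (X.covers (Y.InV⇒∈ (Mates⇒InV mY)))
      ... | v , mX = subst (Mates X _) (mates-functional (X⊆Y mX) mY) mX

      same-mates⇒SameSubgraph : (∀ {x y} → Mates X x y → Mates Y x y) → SameSubgraph X Y
      same-mates⇒SameSubgraph X⊆Y =
        (λ x → mk⇔ (λ x∈X → Y.covers (X.InV⇒∈ x∈X)) (λ x∈Y → X.covers (Y.InV⇒∈ x∈Y))) ,
        (λ x y → mk⇔ (InE-transfer X Y X⊆A Y⊆A (mates-reflect X⊆Y)) (InE-transfer Y X Y⊆A X⊆A X⊆Y))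

    meets⇒inside : 3 ≤ p → (X Y : K2 p G) → InsideOf X A → InsideOf Y A → ¬ SameSubgraph X Y →
                   (M : K2 p G) → ∀ {x} → InV M x → x ∈ A → InsideOf M A
    meets⇒inside 3≤p X Y X⊆A Y⊆A X≠Y M (i₀ , a₀ , refl) x∈A i a =
      decidable-stable (emb M i a ∈? A) λ ia∉A →
        X≠Y (same-mates⇒SameSubgraph (mates-agree (at-most-two-universal {j = i , a} ia∉A)))
      where
      open TwoInside X Y X⊆A Y⊆A
      open Meets X X⊆A 3≤p M (i₀ , a₀) x∈A

lemma10 : (p : ℕ) → 3 ≤ p → (n : ℕ) → (G : Graph n) →
          (∀ v → degree G v ≤ (2 * p ∸ 2) + 1) →
          (A : Subset n) → Dense p G A →
          (K : K2 p G) → (∃[ x ] (InV K x × x ∈ A)) →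
          ∀ x → InV K x ⇔ x ∈ A
lemma10 p 3≤p@(s≤s (s≤s (s≤s _))) _ G Δ≤ A (∣A∣≡2p , X , Y , X⊆A , Y⊆A , X≠Y) K (_ , x₀∈K , x₀∈A) _ =
  mk⇔ K.InV⇒∈ K.covers
  where
  open Bounded G {p} (λ v → ≤-<-trans (Δ≤ v) (m∸2+1<m (s≤s (s≤s z≤n)))) A (≤-reflexive ∣A∣≡2p)
  module K = Inside K (meets⇒inside 3≤p X Y X⊆A Y⊆A X≠Y K x₀∈K x₀∈A)
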